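{- Let $G$ be a (finite, loopless) multigraph with $\chi_{DP}(G) \leq 3$. Suppose $|V(G)| = n$, $|E(G)| = l$, and $2n \geq l$. Then $P_{DP}(G,3) \geq 3^{\,n - l/2}$.
   Context: All graphs are nonempty, finite, undirected, loopless multigraphs (parallel edges allowed). For vertices $u,v$ of $G$, $E_G(u,v)$ is the set of edges with endpoints $u$ and $v$ and $e_G(u,v)=|E_G(u,v)|$. A cover of $G$ is a triple $\mathcal{H}=(L,H,M)$ where $L$ assigns to each $v\in V(G)$ a set $L(v)=\{(v,a): a\in A_v\}$ with $A_v$ a nonempty finite set, $H$ is a multigraph with vertex set $\bigcup_{v} L(v)$, and $M$ assigns to each edge $e\in E(G)$ with endpoints $u,v$ a matching $M(e)$ each of whose edges has one endpoint in $L(u)$ and the other in $L(v)$, such that: (1) $H[L(u)]$ is a complete graph for every $u$; (2) $M(e_1)\cap M(e_2)=\emptyset$ for distinct edges $e_1,e_2$; (3) for distinct $u,v$, the set of edges of $H$ between $L(u)$ and $L(v)$ is $\bigcup_{e\in E_G(u,v)} M(e)$. An $\mathcal{H}$-coloring of $G$ is an independent set in $H$ of size $|V(G)|$. The cover is $m$-fold if $|L(u)|=m$ for all $u$, and a full $m$-fold cover if moreover $H$ has exactly $e_G(u,v)\,m$ edges between $L(u)$ and $L(v)$ for all distinct $u,v$. The DP-chromatic number $\chi_{DP}(G)$ is the least $k$ such that $G$ has an $\mathcal{H}$-coloring for every $k$-fold cover $\mathcal{H}$. $P_{DP}(G,m)$ (the DP color function) is the minimum, over all full $m$-fold covers $\mathcal{H}$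 of $G$, of the number of $\mathcal{H}$-colorings of $G$. -}

module Defs where

open import Data.Nat using (ℕ; zero; suc; _+_; _*_; _∸_; _^_; _≤_)
import Data.Nat as ℕ
open import Data.Bool using (Bool; true; false)
import Data.Bool as 𝔹
open import Data.Fin using (Fin)
import Data.Fin as F
open import Data.Fin.Properties using (all?; any?)
open import Data.Fin.Subset using (Subset; ∣_∣)
open import Data.Vec using (Vec; []; _∷_; lookup)
open import Data.List using (List; []; _∷_; length; filter; map; concatMap; allFin)
open import Data.Nat.ListAction using (sum)
open import Data.Product using (Σ; ∃; _×_; _,_; proj₁; proj₂)
open import Data.Product.Properties using (≡-dec)
open import Data.Sum using (_⊎_)
open import Relation.Nullary using (¬_; Dec; ¬?)
open import Relation.Nullary.Decidable using (_×-dec_; _⊎-dec_; _→-dec_)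
open import Relation.Binary.PropositionalEquality using (_≡_; _≢_)

-- Loopless multigraphs with vertex set Fin n and edge set Fin l.
-- Each edge e has an (arbitrarily oriented) pair of distinct endpoints.

record Multigraph (n l : ℕ) : Set where
  field
    ends     : Fin l → Fin n × Fin n
    loopless : ∀ e → proj₁ (ends e) ≢ proj₂ (ends e)
open Multigraph public

Joins : ∀ {n l} → Multigraph n l → Fin l → Fin n → Fin n → Set
Joins G e u v = (ends G e ≡ (u , v)) ⊎ (ends G e ≡ (v , u))

joins? : ∀ {n l} (G : Multigraph n l) e u v → Dec (Joins G e u v)
joins? G e u v = ≡-dec F._≟_ F._≟_ (ends G e) (u , v) ⊎-dec ≡-dec F._≟_ F._≟_ (ends G e) (v , u)

EG : ∀ {n l} → Multigraph n l → Fin n → Fin n → List (Fin l)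
EG G u v = filter (λ e → joins? G e u v) (allFin _)

eG : ∀ {n l} → Multigraph n l → Fin n → Fin n → ℕ
eG G u v = length (EG G u v)

-- L(v) = {(v,a) : a ∈ Fin m}.  For each edge e with
-- ends G e = (u , v), M e a b ≡ true means that the edge of H in M(e)
-- joins (u,a) and (v,b).  H is the graph on
-- Σ (Fin n) Fin m-pairs whose edges are: complete graphs on each L(u),
-- plus the (pairwise disjoint, labelled by e) matchings M(e).

record Cover {n l} (G : Multigraph n l) (m : ℕ) : Set where
  field
    M      : Fin l → Fin m → Fin m → Bool
    match₁ : ∀ e a b b′ → M e a b ≡ true → M e a b′ ≡ true → b ≡ b′
    match₂ : ∀ e a a′ b → M e a b ≡ true → M e a′ b ≡ true → a ≡ a′
open Cover public

Adj : ∀ {n l m} {G : Multigraph n l} → Cover G m →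
      Fin n → Fin m → Fin n → Fin m → Set
Adj {l = l} {G = G} H v a w b =
  ((v ≡ w) × (a ≢ b)) ⊎
  (Σ (Fin l) λ e → ((ends G e ≡ (v , w)) × (M H e a b ≡ true)) ⊎
                   ((ends G e ≡ (w , v)) × (M H e b a ≡ true)))

adj? : ∀ {n l m} {G : Multigraph n l} (H : Cover G m) v a w b → Dec (Adj H v a w b)
adj? {G = G} H v a w b =
  (v F.≟ w ×-dec ¬? (a F.≟ b)) ⊎-dec
  any? (λ e → (≡-dec F._≟_ F._≟_ (ends G e) (v , w) ×-dec (M H e a b 𝔹.≟ true)) ⊎-dec
              (≡-dec F._≟_ F._≟_ (ends G e) (w , v) ×-dec (M H e b a 𝔹.≟ true)))

-- subsets of V(H): S v a ≡ true iff (v,a) ∈ S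
VSubset : ℕ → ℕ → Set
VSubset n m = Vec (Subset m) n

Independent : ∀ {n l m} {G : Multigraph n l} → Cover G m → VSubset n m → Set
Independent H S = ∀ v a w b → lookup (lookup S v) a ≡ true →
                  lookup (lookup S w) b ≡ true → ¬ Adj H v a w b

independent? : ∀ {n l m} {G : Multigraph n l} (H : Cover G m) S → Dec (Independent H S)
independent? H S =
  all? λ v → all? λ a → all? λ w → all? λ b →
    (lookup (lookup S v) a 𝔹.≟ true) →-dec (lookup (lookup S w) b 𝔹.≟ true) →-dec
    ¬? (adj? H v a w b)

size : ∀ {n m} → VSubset n m → ℕ
size []       = 0
size (s ∷ S) = ∣ s ∣ + size S

IsHColoring : ∀ {n l m} {G : Multigraph n l} → Cover G m → VSubset n m → Set
IsHColoring {n = n} H S = Independent H S × (size S ≡ n)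

isHColoring? : ∀ {n l m} {G : Multigraph n l} (H : Cover G m) S → Dec (IsHColoring H S)
isHColoring? {n = n} H S = independent? H S ×-dec (size S ℕ.≟ n)

allVecs : ∀ {A : Set} → List A → (k : ℕ) → List (Vec A k)
allVecs xs zero    = [] ∷ []
allVecs xs (suc k) = concatMap (λ x → map (x ∷_) (allVecs xs k)) xs

allVSubsets : (n m : ℕ) → List (VSubset n m)
allVSubsets n m = allVecs (allVecs (false ∷ true ∷ []) m) n

numColorings : ∀ {n l m} {G : Multigraph n l} → Cover G m → ℕ
numColorings {n} {m = m} H = length (filter (isHColoring? H) (allVSubsets n m))

matchSize : ∀ {n l m} {G : Multigraph n l} → Cover G m → Fin l → ℕ
matchSize {m = m} H e =
  sum (map (λ a → length (filter (λ b → M H e a b 𝔹.≟ true) (allFin m))) (allFin m))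

-- number of edges of H between L(u) and L(v), u ≠ v
-- (= |⋃_{e ∈ E_G(u,v)} M(e)|, the union being disjoint)
crossEdges : ∀ {n l m} {G : Multigraph n l} → Cover G m → Fin n → Fin n → ℕ
crossEdges {G = G} H u v = sum (map (matchSize H) (EG G u v))

IsFull : ∀ {n l m} {G : Multigraph n l} → Cover G m → Set
IsFull {n} {m = m} {G = G} H = ∀ (u v : Fin n) → u ≢ v → crossEdges H u v ≡ eG G u v * m

DPColorableWith : ∀ {n l} → Multigraph n l → ℕ → Set
DPColorableWith {n} G k = ∀ (H : Cover G k) → Σ (VSubset n k) (IsHColoring H)

-- χ_DP(G) ≤ k   (χ_DP(G) is the least k ≥ 1 with the above property)
χDP≤ : ∀ {n l} → Multigraph n l → ℕ → Set
χDP≤ G k = Σ ℕ λ j → (1 ≤ j) × (j ≤ k) × DPColorableWith G j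

{-# OPTIONS --safe #-}
module Submission where

open import Defs
open import Data.Nat using (ℕ; zero; suc; _+_; _*_; _∸_; _^_; _≤_; z≤n; s≤s)
open import Data.Nat.Properties hiding (_≟_)
open import Data.Nat.ListAction using (sum)
open import Data.Nat.Tactic.RingSolver using (solve-∀)
open import Data.Bool using (true; false)
import Data.Bool as 𝔹
open import Data.Fin using (Fin; zero; suc; _≟_; inject≤)
open import Data.Fin.Patterns using (0F; 1F; 2F)
open import Data.Fin.Properties using (all?; inject≤-injective)
import Data.Fin.Properties as Finₚ
open import Data.Fin.Subset using (Subset; ∣_∣; ⁅_⁆)
open import Data.Fin.Subset.Properties using (x∈⁅y⁆⇒x≡y; ∣⁅x⁆∣≡1)
open import Data.Vec using (Vec; []; _∷_; lookup; tabulate)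
import Data.Vec as Vec
open import Data.Vec.Properties using (lookup-map; lookup∘tabulate; lookup⇒[]=)
open import Data.List using (List; []; _∷_; _++_; length; filter; map; concatMap; allFin)
open import Data.List.Properties using (filter-++; length-++; filter-none; filter-some)
import Data.List.Relation.Unary.All as All
open import Data.List.Relation.Unary.Any using (here; there)
open import Data.List.Relation.Unary.AllPairs using (_∷_)
open import Data.List.Relation.Unary.Unique.Propositional using (Unique)
open import Data.List.Relation.Unary.Unique.Propositional.Properties using (allFin⁺)
open import Data.List.Membership.Propositional using (_∈_)
open import Data.List.Membership.Propositional.Properties using (∈-filter⁺; ∈-allFin)
open import Data.Product using (Σ; ∃; _×_; _,_; proj₁; proj₂)
open import Data.Sum using (_⊎_; inj₁; inj₂)
open import Data.Unit using (⊤; tt)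
open import Data.Empty using (⊥-elim)
open import Function using (_∘_)
open import Relation.Nullary using (¬_; yes; no; ¬?)
open import Relation.Nullary.Decidable using (toWitness; _→-dec_; decidable-stable)
open import Relation.Unary using (Decidable)
open import Relation.Binary.PropositionalEquality

-- A full 3-fold cover pairs the colours at the two ends of every
-- edge e by a perfect matching, i.e. a permutation π_e of 𝔽₃, and every
-- permutation of 𝔽₃ is affine.  Hence the H-colourings are exactly the
-- points of 𝔽₃ⁿ where the polynomial ∏_e (x_v − π_e(x_u)) of degree ≤ l
-- is nonzero.  Since χ_DP(G) ≤ 3 there is such a point, and an
-- Alon–Füredi-type bound says that a polynomial of degree ≤ d over 𝔽₃
-- which is not identically zero on 𝔽₃ⁿ has N nonzeros with N² ≥ 3^(2n−d).
-- That bound is proved by induction on n, cutting 𝔽₃ⁿ into the three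
-- slices x₀ = a: each nonzero slice has degree ≤ d, and if k slices
-- vanish identically the remaining ones have degree ≤ d − k.

𝔽₃ : Set
𝔽₃ = Fin 3

infixl 6 _+₃_ _-₃_
infixl 7 _·₃_
infix  8 -₃_

_+₃_ : 𝔽₃ → 𝔽₃ → 𝔽₃
0F +₃ b  = b
1F +₃ 0F = 1F
1F +₃ 1F = 2F
1F +₃ 2F = 0F
2F +₃ 0F = 2F
2F +₃ 1F = 0F
2F +₃ 2F = 1F

-₃_ : 𝔽₃ → 𝔽₃
-₃ 0F = 0F
-₃ 1F = 2F
-₃ 2F = 1F

_-₃_ : 𝔽₃ → 𝔽₃ → 𝔽₃
a -₃ b = a +₃ -₃ b

_·₃_ : 𝔽₃ → 𝔽₃ → 𝔽₃
0F ·₃ b = 0F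
1F ·₃ b = b
2F ·₃ b = -₃ b

-- Identities in 𝔽₃ are proved by evaluating both sides at all arguments.

+₃-identityʳ : ∀ a → a +₃ 0F ≡ a
+₃-identityʳ = toWitness {a? = all? λ a → _ ≟ _} tt

-₃-involutive : ∀ a → -₃ -₃ a ≡ a
-₃-involutive = toWitness {a? = all? λ a → _ ≟ _} tt

-₃-inverseʳ : ∀ a → a -₃ a ≡ 0F
-₃-inverseʳ = toWitness {a? = all? λ a → _ ≟ _} tt

-₃≡0⇒≡ : ∀ a b → a -₃ b ≡ 0F → a ≡ b
-₃≡0⇒≡ = toWitness {a? = all? λ a → all? λ b → (_ ≟ _) →-dec (_ ≟ _)} tt

·₃-zeroʳ : ∀ a → a ·₃ 0F ≡ 0F
·₃-zeroʳ = toWitness {a? = all? λ a → _ ≟ _} tt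

·₃-nonzero : ∀ {a b} → a ≢ 0F → b ≢ 0F → a ·₃ b ≢ 0F
·₃-nonzero {0F}          a≢0 _   = ⊥-elim (a≢0 refl)
·₃-nonzero {suc _} {0F}  _   b≢0 = ⊥-elim (b≢0 refl)
·₃-nonzero {1F}    {1F}  _   _   ()
·₃-nonzero {1F}    {2F}  _   _   ()
·₃-nonzero {2F}    {1F}  _   _   ()
·₃-nonzero {2F}    {2F}  _   _   ()

quadratic : 𝔽₃ → 𝔽₃ → 𝔽₃ → 𝔽₃ → 𝔽₃
quadratic c₀ c₁ c₂ a = c₀ +₃ a ·₃ c₁ +₃ a ·₃ a ·₃ c₂

cong-quadratic : ∀ {c₀ c₁ c₂ d₀ d₁ d₂} a → c₀ ≡ d₀ → c₁ ≡ d₁ → c₂ ≡ d₂ →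
                 quadratic c₀ c₁ c₂ a ≡ quadratic d₀ d₁ d₂ a
cong-quadratic a refl refl refl = refl

lagrange-interpolation : ∀ a f₀ f₁ f₂ →
  lookup (f₀ ∷ f₁ ∷ f₂ ∷ []) a ≡ quadratic f₀ (f₂ -₃ f₁) (-₃ (f₀ +₃ f₁ +₃ f₂)) a
lagrange-interpolation =
  toWitness {a? = all? λ a → all? λ f₀ → all? λ f₁ → all? λ f₂ → _ ≟ _} tt

quadratic-zero : ∀ a → quadratic 0F 0F 0F a ≡ 0F
quadratic-zero = toWitness {a? = all? λ a → _ ≟ _} tt

quadratic-difference : ∀ a b c₀ c₁ c₂ →
  quadratic c₀ c₁ c₂ a -₃ quadratic c₀ c₁ c₂ b ≡ (a -₃ b) ·₃ c₁ +₃ (a ·₃ a -₃ b ·₃ b) ·₃ c₂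
quadratic-difference =
  toWitness {a? = all? λ a → all? λ b → all? λ c₀ → all? λ c₁ → all? λ c₂ → _ ≟ _} tt

m+[n-m]≡n : ∀ m n → m +₃ (n -₃ m) ≡ n
m+[n-m]≡n = toWitness {a? = all? λ m → all? λ n → _ ≟ _} tt

injective⇒affine : (p : 𝔽₃ → 𝔽₃) → (∀ {a b} → p a ≡ p b → a ≡ b) →
                   ∀ a → p a ≡ p 0F +₃ a ·₃ (p 1F -₃ p 0F)
injective⇒affine p inj 0F = sym (+₃-identityʳ (p 0F))
injective⇒affine p inj 1F = sym (m+[n-m]≡n (p 0F) (p 1F))
injective⇒affine p inj 2F = third (p 0F) (p 1F) (p 2F) (distinct λ ()) (distinct λ ()) (distinct λ ())
  where
  distinct : ∀ {a b} → a ≢ b → p a ≢ p b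
  distinct a≢b = a≢b ∘ inj
  third : ∀ u v w → u ≢ v → u ≢ w → v ≢ w → w ≡ u +₃ 2F ·₃ (v -₃ u)
  third = toWitness {a? = all? λ u → all? λ v → all? λ w →
            ¬? (u ≟ v) →-dec ¬? (u ≟ w) →-dec ¬? (v ≟ w) →-dec (_ ≟ _)} tt

Fun : ℕ → Set
Fun n = Vec 𝔽₃ n → 𝔽₃

slice : ∀ {n} → 𝔽₃ → Fun (suc n) → Fun n
slice a f x = f (a ∷ x)

coeff₀ coeff₁ coeff₂ : ∀ {n} → Fun (suc n) → Fun n
coeff₀ f x = f (0F ∷ x)
coeff₁ f x = f (2F ∷ x) -₃ f (1F ∷ x)
coeff₂ f x = -₃ (f (0F ∷ x) +₃ f (1F ∷ x) +₃ f (2F ∷ x))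

interpolation : ∀ {n} (f : Fun (suc n)) a x →
                f (a ∷ x) ≡ quadratic (coeff₀ f x) (coeff₁ f x) (coeff₂ f x) a
interpolation f a x = trans (by-slices a) (lagrange-interpolation a _ _ _)
  where
  by-slices : ∀ a → f (a ∷ x) ≡ lookup (f (0F ∷ x) ∷ f (1F ∷ x) ∷ f (2F ∷ x) ∷ []) a
  by-slices 0F = refl
  by-slices 1F = refl
  by-slices 2F = refl

-- DegreeBelow n k f: the reduced polynomial of f has total degree < k,
-- i.e. its coefficient of x₀ⁱ has degree < k − i for i = 0, 1, 2.
DegreeBelow : ∀ n → ℕ → Fun n → Set
DegreeBelow zero    zero    f = f [] ≡ 0F
DegreeBelow zero    (suc k) f = ⊤
DegreeBelow (suc n) k       f =
  DegreeBelow n k (coeff₀ f) × DegreeBelow n (k ∸ 1) (coeff₁ f) × DegreeBelow n (k ∸ 2) (coeff₂ f)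

degreeBelow-cong : ∀ {n k} {f g : Fun n} → f ≗ g → DegreeBelow n k f → DegreeBelow n k g
degreeBelow-cong {zero}  {zero}  f≗g f[]≡0 = trans (sym (f≗g [])) f[]≡0
degreeBelow-cong {zero}  {suc k} _   _     = tt
degreeBelow-cong {suc n}         f≗g (d₀ , d₁ , d₂) =
  degreeBelow-cong (λ x → f≗g (0F ∷ x)) d₀ ,
  degreeBelow-cong (λ x → cong₂ _-₃_ (f≗g (2F ∷ x)) (f≗g (1F ∷ x))) d₁ ,
  degreeBelow-cong (λ x → cong -₃_ (cong₂ _+₃_ (cong₂ _+₃_ (f≗g (0F ∷ x)) (f≗g (1F ∷ x))) (f≗g (2F ∷ x)))) d₂

degreeBelow-mono : ∀ {n k k′} {f : Fun n} → k ≤ k′ → DegreeBelow n k f → DegreeBelow n k′ f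
degreeBelow-mono {zero} {zero}  {zero}   _ d = d
degreeBelow-mono {zero} {zero}  {suc _}  _ _ = tt
degreeBelow-mono {zero} {suc _} {suc _}  _ _ = tt
degreeBelow-mono {suc n} k≤k′ (d₀ , d₁ , d₂) =
  degreeBelow-mono k≤k′ d₀ , degreeBelow-mono (∸-monoˡ-≤ 1 k≤k′) d₁ , degreeBelow-mono (∸-monoˡ-≤ 2 k≤k′) d₂

zero-degreeBelow : ∀ n k → DegreeBelow n k (λ _ → 0F)
zero-degreeBelow zero    zero    = refl
zero-degreeBelow zero    (suc k) = tt
zero-degreeBelow (suc n) k       = zero-degreeBelow n k , zero-degreeBelow n (k ∸ 1) , zero-degreeBelow n (k ∸ 2)

vanishing⇒degreeBelow : ∀ {n k} {f : Fun n} → (∀ x → f x ≡ 0F) → DegreeBelow n k f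
vanishing⇒degreeBelow {n} {k} f≡0 = degreeBelow-cong (sym ∘ f≡0) (zero-degreeBelow n k)

degreeBelow-zero⇒vanishing : ∀ {n} {f : Fun n} → DegreeBelow n 0 f → ∀ x → f x ≡ 0F
degreeBelow-zero⇒vanishing {zero}        f[]≡0          [] = f[]≡0
degreeBelow-zero⇒vanishing {suc n} {f} (d₀ , d₁ , d₂) (a ∷ x) = begin
  f (a ∷ x)                                         ≡⟨ interpolation f a x ⟩
  quadratic (coeff₀ f x) (coeff₁ f x) (coeff₂ f x) a
    ≡⟨ cong-quadratic a (vanishes d₀) (vanishes d₁) (vanishes d₂) ⟩
  quadratic 0F 0F 0F a                              ≡⟨ quadratic-zero a ⟩
  0F                                                ∎
  where
  open ≡-Reasoning
  vanishes : ∀ {g} → DegreeBelow n 0 g → g x ≡ 0F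
  vanishes d = degreeBelow-zero⇒vanishing d x

degreeBelow-+ : ∀ {n k} {f g : Fun n} → DegreeBelow n k f → DegreeBelow n k g →
                DegreeBelow n k (λ x → f x +₃ g x)
degreeBelow-+ {zero} {zero}  f[]≡0 g[]≡0 = cong₂ _+₃_ f[]≡0 g[]≡0
degreeBelow-+ {zero} {suc k} _     _     = tt
degreeBelow-+ {suc n} {f = f} {g} (d₀ , d₁ , d₂) (e₀ , e₁ , e₂) =
  degreeBelow-+ d₀ e₀ ,
  degreeBelow-cong (λ x → sym (coeff₁-+ (f (1F ∷ x)) (f (2F ∷ x)) (g (1F ∷ x)) (g (2F ∷ x)))) (degreeBelow-+ d₁ e₁) ,
  degreeBelow-cong (λ x → sym (coeff₂-+ (f (0F ∷ x)) (f (1F ∷ x)) (f (2F ∷ x)) (g (0F ∷ x)) (g (1F ∷ x)) (g (2F ∷ x))))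
    (degreeBelow-+ d₂ e₂)
  where
  coeff₁-+ : ∀ f₁ f₂ g₁ g₂ → (f₂ +₃ g₂) -₃ (f₁ +₃ g₁) ≡ (f₂ -₃ f₁) +₃ (g₂ -₃ g₁)
  coeff₁-+ = toWitness {a? = all? λ f₁ → all? λ f₂ → all? λ g₁ → all? λ g₂ → _ ≟ _} tt
  coeff₂-+ : ∀ f₀ f₁ f₂ g₀ g₁ g₂ → -₃ ((f₀ +₃ g₀) +₃ (f₁ +₃ g₁) +₃ (f₂ +₃ g₂)) ≡
                                   -₃ (f₀ +₃ f₁ +₃ f₂) +₃ -₃ (g₀ +₃ g₁ +₃ g₂)
  coeff₂-+ = toWitness {a? = all? λ f₀ → all? λ f₁ → all? λ f₂ → all? λ g₀ → all? λ g₁ → all? λ g₂ → _ ≟ _} tt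

coeff₁-· : ∀ c f₁ f₂ → c ·₃ f₂ -₃ c ·₃ f₁ ≡ c ·₃ (f₂ -₃ f₁)
coeff₁-· = toWitness {a? = all? λ c → all? λ f₁ → all? λ f₂ → _ ≟ _} tt

coeff₂-· : ∀ c f₀ f₁ f₂ → -₃ (c ·₃ f₀ +₃ c ·₃ f₁ +₃ c ·₃ f₂) ≡ c ·₃ -₃ (f₀ +₃ f₁ +₃ f₂)
coeff₂-· = toWitness {a? = all? λ c → all? λ f₀ → all? λ f₁ → all? λ f₂ → _ ≟ _} tt

degreeBelow-· : ∀ {n k} c {f : Fun n} → DegreeBelow n k f → DegreeBelow n k (λ x → c ·₃ f x)
degreeBelow-· {zero} {zero}  c f[]≡0 = trans (cong (c ·₃_) f[]≡0) (·₃-zeroʳ c)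
degreeBelow-· {zero} {suc k} c _     = tt
degreeBelow-· {suc n} c {f} (d₀ , d₁ , d₂) =
  degreeBelow-· c d₀ ,
  degreeBelow-cong (λ x → sym (coeff₁-· c (f (1F ∷ x)) (f (2F ∷ x)))) (degreeBelow-· c d₁) ,
  degreeBelow-cong (λ x → sym (coeff₂-· c (f (0F ∷ x)) (f (1F ∷ x)) (f (2F ∷ x)))) (degreeBelow-· c d₂)

degreeBelow-const : ∀ {n k} c → DegreeBelow n (suc k) (λ _ → c)
degreeBelow-const {zero}  c = tt
degreeBelow-const {suc n} c =
  degreeBelow-const c ,
  vanishing⇒degreeBelow (λ _ → -₃-inverseʳ c) ,
  vanishing⇒degreeBelow (λ _ → toWitness {a? = all? λ c → -₃ (c +₃ c +₃ c) ≟ 0F} tt c)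

degreeBelow-var-· : ∀ {n k} (i : Fin n) {f : Fun n} → DegreeBelow n k f →
                    DegreeBelow n (suc k) (λ x → lookup x i ·₃ f x)
degreeBelow-var-· {suc n} {k} zero {f} (d₀ , d₁ , d₂) =
  zero-degreeBelow n (suc k) ,
  degreeBelow-cong (λ x → sym (x₀-coeff₁ (f (0F ∷ x)) (f (1F ∷ x)) (f (2F ∷ x))))
    (degreeBelow-+ d₀ (degreeBelow-mono (m∸n≤m k 2) d₂)) ,
  degreeBelow-cong (λ x → sym (x₀-coeff₂ (f (1F ∷ x)) (f (2F ∷ x)))) d₁
  where
  -- x₀ · (c₀ + x₀ c₁ + x₀² c₂) = x₀ (c₀ + c₂) + x₀² c₁, as x₀³ = x₀ on 𝔽₃.
  x₀-coeff₁ : ∀ f₀ f₁ f₂ → -₃ f₂ -₃ f₁ ≡ f₀ +₃ -₃ (f₀ +₃ f₁ +₃ f₂)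
  x₀-coeff₁ = toWitness {a? = all? λ f₀ → all? λ f₁ → all? λ f₂ → _ ≟ _} tt
  x₀-coeff₂ : ∀ f₁ f₂ → -₃ (f₁ +₃ -₃ f₂) ≡ f₂ -₃ f₁
  x₀-coeff₂ = toWitness {a? = all? λ f₁ → all? λ f₂ → _ ≟ _} tt
degreeBelow-var-· {suc n} {k} (suc j) {f} (d₀ , d₁ , d₂) =
  degreeBelow-var-· j d₀ ,
  degreeBelow-cong (λ x → sym (coeff₁-· (lookup x j) (f (1F ∷ x)) (f (2F ∷ x)))) (raise k d₁) ,
  degreeBelow-cong (λ x → sym (coeff₂-· (lookup x j) (f (0F ∷ x)) (f (1F ∷ x)) (f (2F ∷ x))))
    (raise (k ∸ 1) (subst (λ m → DegreeBelow n m (coeff₂ f)) (sym (∸-+-assoc k 1 1)) d₂))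
  where
  raise : ∀ m {g : Fun n} → DegreeBelow n (m ∸ 1) g → DegreeBelow n m (λ x → lookup x j ·₃ g x)
  raise zero    d = vanishing⇒degreeBelow λ x →
    trans (cong (lookup x j ·₃_) (degreeBelow-zero⇒vanishing d x)) (·₃-zeroʳ (lookup x j))
  raise (suc m) d = degreeBelow-var-· j d

degreeBelow-slice : ∀ {n k} {f : Fun (suc n)} a → DegreeBelow (suc n) k f → DegreeBelow n k (slice a f)
degreeBelow-slice {k = k} {f} a (d₀ , d₁ , d₂) =
  degreeBelow-cong (λ x → sym (interpolation f a x))
    (degreeBelow-+ (degreeBelow-+ d₀ (degreeBelow-· a (degreeBelow-mono (m∸n≤m k 1) d₁)))
                   (degreeBelow-· (a ·₃ a) (degreeBelow-mono (m∸n≤m k 2) d₂)))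

-- Subtracting the vanishing slice b removes the constant coefficient c₀.
degreeBelow-beside-vanishing : ∀ {n k} {f : Fun (suc n)} a b → (∀ x → f (b ∷ x) ≡ 0F) →
                               DegreeBelow (suc n) (suc k) f → DegreeBelow n k (slice a f)
degreeBelow-beside-vanishing {k = k} {f} a b f[b]≡0 (_ , d₁ , d₂) =
  degreeBelow-cong (λ x → sym (difference x))
    (degreeBelow-+ (degreeBelow-· (a -₃ b) d₁)
                   (degreeBelow-· (a ·₃ a -₃ b ·₃ b) (degreeBelow-mono (m∸n≤m k 1) d₂)))
  where
  open ≡-Reasoning
  difference : ∀ x → f (a ∷ x) ≡ (a -₃ b) ·₃ coeff₁ f x +₃ (a ·₃ a -₃ b ·₃ b) ·₃ coeff₂ f x
  difference x = begin
    f (a ∷ x)                ≡⟨ sym (+₃-identityʳ _) ⟩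
    f (a ∷ x) -₃ 0F          ≡⟨ cong (λ t → f (a ∷ x) -₃ t) (sym (f[b]≡0 x)) ⟩
    f (a ∷ x) -₃ f (b ∷ x)   ≡⟨ cong₂ _-₃_ (interpolation f a x) (interpolation f b x) ⟩
    _                        ≡⟨ quadratic-difference a b (coeff₀ f x) (coeff₁ f x) (coeff₂ f x) ⟩
    _                        ∎

-- The slice a is then the sum of all three slices, which is −c₂ = 2 c₂.
degreeBelow-lone-slice : ∀ {n k} {f : Fun (suc n)} a → (∀ x → f ((a +₃ 1F) ∷ x) ≡ 0F) →
                         (∀ x → f ((a +₃ 2F) ∷ x) ≡ 0F) →
                         DegreeBelow (suc n) k f → DegreeBelow n (k ∸ 2) (slice a f)
degreeBelow-lone-slice {f = f} a f[a+1]≡0 f[a+2]≡0 (_ , _ , d₂) =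
  degreeBelow-cong (λ x → trans (-₃-involutive _) (slices-sum a f[a+1]≡0 f[a+2]≡0 x)) (degreeBelow-· 2F d₂)
  where
  slices-sum : ∀ a → (∀ x → f ((a +₃ 1F) ∷ x) ≡ 0F) → (∀ x → f ((a +₃ 2F) ∷ x) ≡ 0F) →
               ∀ x → f (0F ∷ x) +₃ f (1F ∷ x) +₃ f (2F ∷ x) ≡ f (a ∷ x)
  slices-sum 0F z₁ z₂ x rewrite z₁ x | z₂ x = trans (+₃-identityʳ _) (+₃-identityʳ _)
  slices-sum 1F z₂ z₀ x rewrite z₂ x | z₀ x = +₃-identityʳ _
  slices-sum 2F z₀ z₁ x rewrite z₀ x | z₁ x = refl

isNonzero : 𝔽₃ → ℕ
isNonzero 0F      = 0
isNonzero (suc _) = 1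

nonzeros : ∀ n → Fun n → ℕ
nonzeros zero    f = isNonzero (f [])
nonzeros (suc n) f = nonzeros n (slice 0F f) + nonzeros n (slice 1F f) + nonzeros n (slice 2F f)

nonzeros-vanishing : ∀ {n} {f : Fun n} → (∀ x → f x ≡ 0F) → nonzeros n f ≡ 0
nonzeros-vanishing {zero}  f≡0 = cong isNonzero (f≡0 [])
nonzeros-vanishing {suc n} f≡0
  rewrite nonzeros-vanishing {n} (λ x → f≡0 (0F ∷ x))
        | nonzeros-vanishing {n} (λ x → f≡0 (1F ∷ x))
        | nonzeros-vanishing {n} (λ x → f≡0 (2F ∷ x)) = refl

nonzeros≡0⇒vanishing : ∀ {n} {f : Fun n} → nonzeros n f ≡ 0 → ∀ x → f x ≡ 0F
nonzeros≡0⇒vanishing {zero} {f} _ [] with f []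
... | 0F = refl
nonzeros≡0⇒vanishing {suc n} {f} none (a ∷ x) = nonzeros≡0⇒vanishing (slice-none a) x
  where
  c : 𝔽₃ → ℕ
  c a = nonzeros n (slice a f)
  slice-none : ∀ a → c a ≡ 0
  slice-none 0F = m+n≡0⇒m≡0 (c 0F) (m+n≡0⇒m≡0 (c 0F + c 1F) none)
  slice-none 1F = m+n≡0⇒n≡0 (c 0F) (m+n≡0⇒m≡0 (c 0F + c 1F) none)
  slice-none 2F = m+n≡0⇒n≡0 (c 0F + c 1F) none

vanishing-or-positive : ∀ n (f : Fun n) → (∀ x → f x ≡ 0F) ⊎ 1 ≤ nonzeros n f
vanishing-or-positive n f with nonzeros n f in none
... | zero  = inj₁ (nonzeros≡0⇒vanishing none)
... | suc _ = inj₂ (s≤s z≤n)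

positive⇒nonvanishing : ∀ {n} {f : Fun n} → 1 ≤ nonzeros n f → ¬ (∀ x → f x ≡ 0F)
positive⇒nonvanishing pos f≡0 with () ← subst (1 ≤_) (nonzeros-vanishing f≡0) pos

positive⇒¬degreeBelow-zero : ∀ {n} {f : Fun n} → 1 ≤ nonzeros n f → ¬ DegreeBelow n 0 f
positive⇒¬degreeBelow-zero pos = positive⇒nonvanishing pos ∘ degreeBelow-zero⇒vanishing

nonzero-point⇒positive : ∀ {n} {f : Fun n} x → f x ≢ 0F → 1 ≤ nonzeros n f
nonzero-point⇒positive {n} {f} x f[x]≢0 with vanishing-or-positive n f
... | inj₁ f≡0 = ⊥-elim (f[x]≢0 (f≡0 x))
... | inj₂ pos = pos

+-rotate : ∀ x y z → x + y + z ≡ y + z + x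
+-rotate x y z = trans (+-assoc x y z) (+-comm x (y + z))

nonzeros-rotate : ∀ {n} (f : Fun (suc n)) a →
  nonzeros (suc n) f ≡ nonzeros n (slice a f) + nonzeros n (slice (a +₃ 1F) f) + nonzeros n (slice (a +₃ 2F) f)
nonzeros-rotate f 0F = refl
nonzeros-rotate {n} f 1F = +-rotate (nonzeros n (slice 0F f)) _ _
nonzeros-rotate {n} f 2F = trans (+-rotate (nonzeros n (slice 0F f)) _ _) (+-rotate (nonzeros n (slice 1F f)) _ _)

≤-*-of-≤-squares : ∀ {T} x y → T ≤ x * x → T ≤ y * y → T ≤ x * y
≤-*-of-≤-squares {T} x y T≤x² T≤y² with x ≤? y
... | yes x≤y = ≤-trans T≤x² (*-monoʳ-≤ x x≤y)
... | no  x≰y = ≤-trans T≤y² (*-monoˡ-≤ y (<⇒≤ (≰⇒> x≰y)))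

square-of-sum₂ : ∀ {T} x y → T ≤ x * x → T ≤ y * y → 4 * T ≤ (x + y) * (x + y)
square-of-sum₂ {T} x y T≤x² T≤y² = begin
  4 * T                              ≡⟨ four T ⟩
  T + T + (T + T)                    ≤⟨ +-mono-≤ (+-mono-≤ T≤x² (≤-*-of-≤-squares x y T≤x² T≤y²))
                                                (+-mono-≤ (≤-*-of-≤-squares y x T≤y² T≤x²) T≤y²) ⟩
  x * x + x * y + (y * x + y * y)    ≡⟨ expand x y ⟩
  (x + y) * (x + y)                  ∎
  where
  open ≤-Reasoning
  four : ∀ T → 4 * T ≡ T + T + (T + T)
  four = solve-∀
  expand : ∀ x y → x * x + x * y + (y * x + y * y) ≡ (x + y) * (x + y)
  expand = solve-∀

square-of-sum₃ : ∀ {T} x y z → T ≤ x * x → T ≤ y * y → T ≤ z * z → 9 * T ≤ (x + y + z) * (x + y + z)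
square-of-sum₃ {T} x y z T≤x² T≤y² T≤z² = begin
  9 * T                                                           ≡⟨ nine T ⟩
  T + T + T + (T + T + T) + (T + T + T)                           ≤⟨ +-mono-≤ (+-mono-≤ (row x y z T≤x² T≤y² T≤z²)
                                                                                        (row y x z T≤y² T≤x² T≤z²))
                                                                              (row z x y T≤z² T≤x² T≤y²) ⟩
  x * x + x * y + x * z + (y * y + y * x + y * z) + (z * z + z * x + z * y) ≡⟨ expand x y z ⟩
  (x + y + z) * (x + y + z)                                       ∎
  where
  open ≤-Reasoning
  row : ∀ u v w → T ≤ u * u → T ≤ v * v → T ≤ w * w → T + T + T ≤ u * u + u * v + u * w
  row u v w T≤u² T≤v² T≤w² =
    +-mono-≤ (+-mono-≤ T≤u² (≤-*-of-≤-squares u v T≤u² T≤v²)) (≤-*-of-≤-squares u w T≤u² T≤w²)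
  nine : ∀ T → 9 * T ≡ T + T + T + (T + T + T) + (T + T + T)
  nine = solve-∀
  expand : ∀ x y z → x * x + x * y + x * z + (y * y + y * x + y * z) + (z * z + z * x + z * y) ≡
                     (x + y + z) * (x + y + z)
  expand = solve-∀

suc-∸-≤ : ∀ m d → suc m ∸ d ≤ suc (m ∸ d)
suc-∸-≤ m       zero    = ≤-refl
suc-∸-≤ zero    (suc d) = ≤-trans (≤-reflexive (0∸n≡0 d)) z≤n
suc-∸-≤ (suc m) (suc d) = suc-∸-≤ m d

3^-suc-∸ : ∀ m d → 3 ^ (suc m ∸ d) ≤ 3 * 3 ^ (m ∸ d)
3^-suc-∸ m d = ^-monoʳ-≤ 3 (suc-∸-≤ m d)

double-suc : ∀ n → suc n + suc n ≡ suc (suc (n + n))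
double-suc n = cong suc (+-suc n n)

NonzerosBound : ℕ → Set
NonzerosBound n = ∀ d (f : Fun n) → DegreeBelow n (suc d) f → 1 ≤ nonzeros n f →
                  3 ^ (n + n ∸ d) ≤ nonzeros n f * nonzeros n f

nonzerosBound-zero : NonzerosBound 0
nonzerosBound-zero d f _ pos rewrite 0∸n≡0 d = *-mono-≤ pos pos

module _ {n} (bound : NonzerosBound n) (f : Fun (suc n)) where
  open ≤-Reasoning

  private
    N : ℕ
    N = nonzeros (suc n) f
    c : 𝔽₃ → ℕ
    c a = nonzeros n (slice a f)

  no-slice-vanishes : ∀ {d} → DegreeBelow (suc n) (suc d) f → 1 ≤ c 0F → 1 ≤ c 1F → 1 ≤ c 2F →
                      3 ^ (suc n + suc n ∸ d) ≤ N * N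
  no-slice-vanishes {d} deg p₀ p₁ p₂ = begin
    3 ^ (suc n + suc n ∸ d)          ≡⟨ cong (λ m → 3 ^ (m ∸ d)) (double-suc n) ⟩
    3 ^ (suc (suc (n + n)) ∸ d)      ≤⟨ 3^-suc-∸ (suc (n + n)) d ⟩
    3 * 3 ^ (suc (n + n) ∸ d)        ≤⟨ *-monoʳ-≤ 3 (3^-suc-∸ (n + n) d) ⟩
    3 * (3 * 3 ^ (n + n ∸ d))        ≡⟨ sym (*-assoc 3 3 (3 ^ (n + n ∸ d))) ⟩
    9 * 3 ^ (n + n ∸ d)              ≤⟨ square-of-sum₃ (c 0F) (c 1F) (c 2F)
                                          (slice-bound 0F p₀) (slice-bound 1F p₁) (slice-bound 2F p₂) ⟩
    N * N                            ∎
    where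
    slice-bound : ∀ a → 1 ≤ c a → 3 ^ (n + n ∸ d) ≤ c a * c a
    slice-bound a = bound d (slice a f) (degreeBelow-slice {f = f} a deg)

  one-slice-vanishes : ∀ {d} b → (∀ x → f (b ∷ x) ≡ 0F) → DegreeBelow (suc n) (suc d) f →
                       1 ≤ c (b +₃ 1F) → 1 ≤ c (b +₃ 2F) → 3 ^ (suc n + suc n ∸ d) ≤ N * N
  one-slice-vanishes {zero} b f[b]≡0 deg p _ =
    ⊥-elim (positive⇒¬degreeBelow-zero p (degreeBelow-beside-vanishing {f = f} (b +₃ 1F) b f[b]≡0 deg))
  one-slice-vanishes {suc d} b f[b]≡0 deg p q = begin
    3 ^ (suc n + suc n ∸ suc d)      ≡⟨ cong (λ m → 3 ^ (m ∸ suc d)) (double-suc n) ⟩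
    3 ^ (suc (n + n) ∸ d)            ≤⟨ 3^-suc-∸ (n + n) d ⟩
    3 * 3 ^ (n + n ∸ d)              ≤⟨ *-monoˡ-≤ (3 ^ (n + n ∸ d)) (n≤1+n 3) ⟩
    4 * 3 ^ (n + n ∸ d)              ≤⟨ square-of-sum₂ (c (b +₃ 1F)) (c (b +₃ 2F))
                                          (beside-bound (b +₃ 1F) p) (beside-bound (b +₃ 2F) q) ⟩
    (c (b +₃ 1F) + c (b +₃ 2F)) * (c (b +₃ 1F) + c (b +₃ 2F)) ≡⟨ cong (λ m → m * m) (sym N≡) ⟩
    N * N                            ∎
    where
    beside-bound : ∀ a → 1 ≤ c a → 3 ^ (n + n ∸ d) ≤ c a * c a
    beside-bound a = bound d (slice a f) (degreeBelow-beside-vanishing {f = f} a b f[b]≡0 deg)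
    N≡ : N ≡ c (b +₃ 1F) + c (b +₃ 2F)
    N≡ = trans (nonzeros-rotate f b) (cong (λ m → m + c (b +₃ 1F) + c (b +₃ 2F)) (nonzeros-vanishing f[b]≡0))

  two-slices-vanish : ∀ {d} a → (∀ x → f ((a +₃ 1F) ∷ x) ≡ 0F) → (∀ x → f ((a +₃ 2F) ∷ x) ≡ 0F) →
                      DegreeBelow (suc n) (suc d) f → 1 ≤ c a → 3 ^ (suc n + suc n ∸ d) ≤ N * N
  two-slices-vanish {zero} a z₁ z₂ deg p =
    ⊥-elim (positive⇒¬degreeBelow-zero p (degreeBelow-lone-slice {f = f} a z₁ z₂ deg))
  two-slices-vanish {suc zero} a z₁ z₂ deg p =
    ⊥-elim (positive⇒¬degreeBelow-zero p (degreeBelow-lone-slice {f = f} a z₁ z₂ deg))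
  two-slices-vanish {suc (suc d)} a z₁ z₂ deg p = begin
    3 ^ (suc n + suc n ∸ suc (suc d)) ≡⟨ cong (λ m → 3 ^ (m ∸ suc (suc d))) (double-suc n) ⟩
    3 ^ (n + n ∸ d)                   ≤⟨ bound d (slice a f) (degreeBelow-lone-slice {f = f} a z₁ z₂ deg) p ⟩
    c a * c a                         ≤⟨ *-mono-≤ c≤N c≤N ⟩
    N * N                             ∎
    where
    c≤N : c a ≤ N
    c≤N = subst (c a ≤_) (sym (nonzeros-rotate f a)) (≤-trans (m≤m+n _ _) (m≤m+n _ _))

nonzerosBound-suc : ∀ {n} → NonzerosBound n → NonzerosBound (suc n)
nonzerosBound-suc {n} bound d f deg pos
  with vanishing-or-positive n (slice 0F f) | vanishing-or-positive n (slice 1F f) | vanishing-or-positive n (slice 2F f)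
... | inj₂ p₀ | inj₂ p₁ | inj₂ p₂ = no-slice-vanishes bound f deg p₀ p₁ p₂
... | inj₁ z₀ | inj₂ p₁ | inj₂ p₂ = one-slice-vanishes bound f 0F z₀ deg p₁ p₂
... | inj₂ p₀ | inj₁ z₁ | inj₂ p₂ = one-slice-vanishes bound f 1F z₁ deg p₂ p₀
... | inj₂ p₀ | inj₂ p₁ | inj₁ z₂ = one-slice-vanishes bound f 2F z₂ deg p₀ p₁
... | inj₂ p₀ | inj₁ z₁ | inj₁ z₂ = two-slices-vanish bound f 0F z₁ z₂ deg p₀
... | inj₁ z₀ | inj₂ p₁ | inj₁ z₂ = two-slices-vanish bound f 1F z₂ z₀ deg p₁
... | inj₁ z₀ | inj₁ z₁ | inj₂ p₂ = two-slices-vanish bound f 2F z₀ z₁ deg p₂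
... | inj₁ z₀ | inj₁ z₁ | inj₁ z₂ =
  ⊥-elim (positive⇒nonvanishing {f = f} pos λ { (0F ∷ x) → z₀ x ; (1F ∷ x) → z₁ x ; (2F ∷ x) → z₂ x })

nonzerosBound : ∀ n → NonzerosBound n
nonzerosBound zero    = nonzerosBound-zero
nonzerosBound (suc n) = nonzerosBound-suc (nonzerosBound n)

positive-filter⇒∃ : ∀ {A : Set} {P : A → Set} (P? : Decidable P) xs → 1 ≤ length (filter P? xs) → ∃ P
positive-filter⇒∃ P? (x ∷ xs) pos with P? x
... | yes px = x , px
... | no  _  = positive-filter⇒∃ P? xs pos

filter-length-≤1 : ∀ {A : Set} {P : A → Set} (P? : Decidable P) {xs} → Unique xs →
                   (∀ {x y} → P x → P y → x ≡ y) → length (filter P? xs) ≤ 1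
filter-length-≤1 P? {[]}     _                 _      = z≤n
filter-length-≤1 P? {x ∷ xs} (x∉xs ∷ xs-unique) single with P? x
... | no  _  = filter-length-≤1 P? xs-unique single
... | yes px = s≤s (≤-reflexive (cong length
                 (filter-none P? (All.map (λ x≢y py → x≢y (single px py)) x∉xs))))

+-equal-bounds : ∀ {a b c d} → a ≤ b → c ≤ d → a + c ≡ b + d → a ≡ b × c ≡ d
+-equal-bounds {a} {b} {c} {d} a≤b c≤d a+c≡b+d = a≡b , +-cancelˡ-≡ b c d (trans (cong (_+ c) (sym a≡b)) a+c≡b+d)
  where
  a≡b : a ≡ b
  a≡b = ≤-antisym a≤b (+-cancelʳ-≤ d b a (≤-trans (≤-reflexive (sym a+c≡b+d)) (+-monoʳ-≤ a c≤d)))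

sum-map-≤ : ∀ {A : Set} {c} (g : A → ℕ) xs → (∀ x → g x ≤ c) → sum (map g xs) ≤ length xs * c
sum-map-≤ g []       _   = z≤n
sum-map-≤ g (x ∷ xs) g≤c = +-mono-≤ (g≤c x) (sum-map-≤ g xs g≤c)

sum-map-maximal : ∀ {A : Set} {c} (g : A → ℕ) xs → (∀ x → g x ≤ c) → sum (map g xs) ≡ length xs * c →
                  ∀ {x} → x ∈ xs → g x ≡ c
sum-map-maximal g (x ∷ xs) g≤c sum≡ (here refl) = proj₁ (+-equal-bounds (g≤c x) (sum-map-≤ g xs g≤c) sum≡)
sum-map-maximal g (x ∷ xs) g≤c sum≡ (there x∈xs) =
  sum-map-maximal g xs g≤c (proj₂ (+-equal-bounds (g≤c x) (sum-map-≤ g xs g≤c) sum≡)) x∈xs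

∣p∣≤1 : ∀ {m} (p : Subset m) → (∀ a b → lookup p a ≡ true → lookup p b ≡ true → a ≡ b) → ∣ p ∣ ≤ 1
∣p∣≤1 []          _      = z≤n
∣p∣≤1 (true ∷ p)  single =
  s≤s (≤-reflexive (∣p∣≡0 p (λ i p[i] → Finₚ.0≢1+n (single zero (suc i) refl p[i]))))
  where
  ∣p∣≡0 : ∀ {m} (p : Subset m) → (∀ i → lookup p i ≢ true) → ∣ p ∣ ≡ 0
  ∣p∣≡0 []         _     = refl
  ∣p∣≡0 (true ∷ p)  empty = ⊥-elim (empty zero refl)
  ∣p∣≡0 (false ∷ p) empty = ∣p∣≡0 p (empty ∘ suc)
∣p∣≤1 (false ∷ p) single = ∣p∣≤1 p (λ a b p[a] p[b] → Finₚ.suc-injective (single (suc a) (suc b) p[a] p[b]))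

∣p∣≥1⇒member : ∀ {m} (p : Subset m) → 1 ≤ ∣ p ∣ → Σ (Fin m) λ a → lookup p a ≡ true
∣p∣≥1⇒member (true  ∷ p) _   = zero , refl
∣p∣≥1⇒member (false ∷ p) pos with ∣p∣≥1⇒member p pos
... | a , p[a] = suc a , p[a]

size≡n⇒nonempty : ∀ {n m} (S : VSubset n m) → (∀ v → ∣ lookup S v ∣ ≤ 1) → size S ≡ n →
                  ∀ v → 1 ≤ ∣ lookup S v ∣
size≡n⇒nonempty (s ∷ S) ≤1 size≡ = λ where
    zero    → ≤-reflexive (sym (proj₁ split))
    (suc v) → size≡n⇒nonempty S (≤1 ∘ suc) (proj₂ split) v
  where
  size-≤ : ∀ {n} (S : VSubset n _) → (∀ v → ∣ lookup S v ∣ ≤ 1) → size S ≤ n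
  size-≤ []      _  = z≤n
  size-≤ (s ∷ S) ≤1 = +-mono-≤ (≤1 zero) (size-≤ S (≤1 ∘ suc))
  split = +-equal-bounds (≤1 zero) (size-≤ S (≤1 ∘ suc)) size≡

ProperChoice : ∀ {n l m} {G : Multigraph n l} → Cover G m → (Fin n → Fin m) → Set
ProperChoice {G = G} H c = ∀ e → M H e (c (proj₁ (ends G e))) (c (proj₂ (ends G e))) ≢ true

properChoice-cong : ∀ {n l m} {G : Multigraph n l} (H : Cover G m) {c c′ : Fin n → Fin m} →
                    c ≗ c′ → ProperChoice H c → ProperChoice H c′
properChoice-cong H c≗c′ proper e = proper e ∘ subst₂ (λ a b → M H e a b ≡ true) (sym (c≗c′ _)) (sym (c≗c′ _))

size-singletons : ∀ {n m} (x : Vec (Fin m) n) → size (Vec.map ⁅_⁆ x) ≡ n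
size-singletons []      = refl
size-singletons (a ∷ x) = cong₂ _+_ (∣⁅x⁆∣≡1 a) (size-singletons x)

properChoice⇒coloring : ∀ {n l m} {G : Multigraph n l} (H : Cover G m) (x : Vec (Fin m) n) →
                        ProperChoice H (lookup x) → IsHColoring H (Vec.map ⁅_⁆ x)
properChoice⇒coloring {G = G} H x proper = independent , size-singletons x
  where
  chosen : ∀ {v a} → lookup (lookup (Vec.map ⁅_⁆ x) v) a ≡ true → a ≡ lookup x v
  chosen {v} {a} a∈S = x∈⁅y⁆⇒x≡y (lookup x v)
    (lookup⇒[]= a _ (trans (cong (λ s → lookup s a) (sym (lookup-map v ⁅_⁆ x))) a∈S))
  matched : ∀ {e a b} v w → ends G e ≡ (v , w) → a ≡ lookup x v → b ≡ lookup x w → M H e a b ≢ true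
  matched {e} v w refl refl refl = proper e
  independent : Independent H (Vec.map ⁅_⁆ x)
  independent v a w b a∈S b∈S (inj₁ (refl , a≢b))            = a≢b (trans (chosen a∈S) (sym (chosen b∈S)))
  independent v a w b a∈S b∈S (inj₂ (e , inj₁ (ends≡ , Mab))) = matched v w ends≡ (chosen a∈S) (chosen b∈S) Mab
  independent v a w b a∈S b∈S (inj₂ (e , inj₂ (ends≡ , Mba))) = matched w v ends≡ (chosen b∈S) (chosen a∈S) Mba

coloring⇒properChoice : ∀ {n l m} {G : Multigraph n l} (H : Cover G m) S →
                        IsHColoring H S → Σ (Fin n → Fin m) (ProperChoice H)
coloring⇒properChoice H S (independent , size≡n) = colour , proper
  where
  single : ∀ v a b → lookup (lookup S v) a ≡ true → lookup (lookup S v) b ≡ true → a ≡ b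
  single v a b a∈S b∈S = decidable-stable (a ≟ b) λ a≢b → independent v a v b a∈S b∈S (inj₁ (refl , a≢b))
  member : ∀ v → Σ (Fin _) λ a → lookup (lookup S v) a ≡ true
  member v = ∣p∣≥1⇒member (lookup S v) (size≡n⇒nonempty S (λ w → ∣p∣≤1 (lookup S w) (single w)) size≡n v)
  colour : Fin _ → Fin _
  colour v = proj₁ (member v)
  proper : ProperChoice H colour
  proper e Mab = independent _ _ _ _ (proj₂ (member _)) (proj₂ (member _)) (inj₂ (e , inj₁ (refl , Mab)))

restrict : ∀ {n l m j} {G : Multigraph n l} → j ≤ m → Cover G m → Cover G j
restrict j≤m H = record
  { M      = λ e a b → M H e (inject≤ a j≤m) (inject≤ b j≤m)
  ; match₁ = λ e a b b′ p q → inject≤-injective j≤m j≤m b b′ (match₁ H e _ _ _ p q)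
  ; match₂ = λ e a a′ b p q → inject≤-injective j≤m j≤m a a′ (match₂ H e _ _ _ p q)
  }

χDP≤⇒properChoice : ∀ {n l m} {G : Multigraph n l} → χDP≤ G m →
                    (H : Cover G m) → Σ (Fin n → Fin m) (ProperChoice H)
χDP≤⇒properChoice (j , _ , j≤m , colourable) H
  with S , coloring ← colourable (restrict j≤m H)
  with c , proper ← coloring⇒properChoice (restrict j≤m H) S coloring
  = (λ v → inject≤ (c v) j≤m) , proper

length-filter-map : ∀ {A B : Set} {P : B → Set} (P? : Decidable P) (g : A → B) xs →
                    length (filter P? (map g xs)) ≡ length (filter (P? ∘ g) xs)
length-filter-map P? g []       = refl
length-filter-map P? g (x ∷ xs) with P? (g x)
... | yes _ = cong suc (length-filter-map P? g xs)
... | no  _ = length-filter-map P? g xs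

length-filter-concatMap : ∀ {A B : Set} {P : B → Set} (P? : Decidable P) (g : A → List B) xs →
                          length (filter P? (concatMap g xs)) ≡ sum (map (λ x → length (filter P? (g x))) xs)
length-filter-concatMap P? g []       = refl
length-filter-concatMap P? g (x ∷ xs) = begin
  length (filter P? (g x ++ concatMap g xs))                ≡⟨ cong length (filter-++ P? (g x) (concatMap g xs)) ⟩
  length (filter P? (g x) ++ filter P? (concatMap g xs))    ≡⟨ length-++ (filter P? (g x)) ⟩
  length (filter P? (g x)) + length (filter P? (concatMap g xs))
                                                            ≡⟨ cong (length (filter P? (g x)) +_) (length-filter-concatMap P? g xs) ⟩
  length (filter P? (g x)) + sum (map (λ x → length (filter P? (g x))) xs) ∎
  where open ≡-Reasoning

-- ⁅ 0F ⁆, ⁅ 1F ⁆ and ⁅ 2F ⁆ are the terms r₄, r₂ and r₁ of the enumeration.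
singletons-≤-sum : (T : Subset 3 → ℕ) → T ⁅ 0F ⁆ + T ⁅ 1F ⁆ + T ⁅ 2F ⁆ ≤ sum (map T (allVecs (false ∷ true ∷ []) 3))
singletons-≤-sum T = pick (T _) (T _) (T _) (T _) (T _) (T _) (T _) (T _)
  where
  rearrange : ∀ r₀ r₁ r₂ r₃ r₄ r₅ r₆ r₇ → r₀ + (r₁ + (r₂ + (r₃ + (r₄ + (r₅ + (r₆ + (r₇ + 0))))))) ≡
                                          r₄ + r₂ + r₁ + (r₀ + r₃ + r₅ + r₆ + r₇)
  rearrange = solve-∀
  pick : ∀ r₀ r₁ r₂ r₃ r₄ r₅ r₆ r₇ → r₄ + r₂ + r₁ ≤ r₀ + (r₁ + (r₂ + (r₃ + (r₄ + (r₅ + (r₆ + (r₇ + 0)))))))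
  pick r₀ r₁ r₂ r₃ r₄ r₅ r₆ r₇ =
    subst (r₄ + r₂ + r₁ ≤_) (sym (rearrange r₀ r₁ r₂ r₃ r₄ r₅ r₆ r₇)) (m≤m+n (r₄ + r₂ + r₁) _)

nonzeros≤count : ∀ n (f : Fun n) {Q : VSubset n 3 → Set} (Q? : Decidable Q) →
                 (∀ x → f x ≢ 0F → Q (Vec.map ⁅_⁆ x)) → nonzeros n f ≤ length (filter Q? (allVSubsets n 3))
nonzeros≤count zero f Q? good with f [] in f[]≡
... | 0F    = z≤n
... | suc _ = filter-some Q? (here (good [] λ f[]≡0 → Finₚ.0≢1+n (trans (sym f[]≡0) f[]≡)))
nonzeros≤count (suc n) f Q? good = begin
  nonzeros (suc n) f                            ≤⟨ +-mono-≤ (+-mono-≤ (slice-≤ 0F) (slice-≤ 1F)) (slice-≤ 2F) ⟩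
  T ⁅ 0F ⁆ + T ⁅ 1F ⁆ + T ⁅ 2F ⁆                ≤⟨ singletons-≤-sum T ⟩
  sum (map T (allVecs (false ∷ true ∷ []) 3))   ≡⟨ sym (length-filter-concatMap Q? (λ s → map (s ∷_) (allVSubsets n 3))
                                                                             (allVecs (false ∷ true ∷ []) 3)) ⟩
  length (filter Q? (allVSubsets (suc n) 3))    ∎
  where
  open ≤-Reasoning
  T : Subset 3 → ℕ
  T s = length (filter Q? (map (s ∷_) (allVSubsets n 3)))
  slice-≤ : ∀ a → nonzeros n (slice a f) ≤ T ⁅ a ⁆
  slice-≤ a = ≤-trans (nonzeros≤count n (slice a f) (Q? ∘ (⁅ a ⁆ ∷_)) (λ x → good (a ∷ x)))
                      (≤-reflexive (sym (length-filter-map Q? (⁅ a ⁆ ∷_) (allVSubsets n 3))))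

∏ : ∀ {n l} → (Fin l → Fun n) → Fun n
∏ {l = zero}  φ x = 1F
∏ {l = suc l} φ x = φ zero x ·₃ ∏ (φ ∘ suc) x

degreeBelow-∏ : ∀ {n l} (φ : Fin l → Fun n) →
                (∀ e {k} {g : Fun n} → DegreeBelow n k g → DegreeBelow n (suc k) (λ x → φ e x ·₃ g x)) →
                DegreeBelow n (suc l) (∏ φ)
degreeBelow-∏ {l = zero}  φ _      = degreeBelow-const 1F
degreeBelow-∏ {l = suc l} φ raises = raises zero (degreeBelow-∏ (φ ∘ suc) (raises ∘ suc))

∏-zero : ∀ {n l} (φ : Fin l → Fun n) x e → φ e x ≡ 0F → ∏ φ x ≡ 0F
∏-zero φ x zero    φ[e]≡0 = cong (_·₃ ∏ (φ ∘ suc) x) φ[e]≡0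
∏-zero φ x (suc e) φ[e]≡0 = trans (cong (φ zero x ·₃_) (∏-zero (φ ∘ suc) x e φ[e]≡0)) (·₃-zeroʳ (φ zero x))

∏-nonzero : ∀ {n l} (φ : Fin l → Fun n) x → (∀ e → φ e x ≢ 0F) → ∏ φ x ≢ 0F
∏-nonzero {l = zero}  φ x _       ()
∏-nonzero {l = suc l} φ x nonzero = ·₃-nonzero (nonzero zero) (∏-nonzero (φ ∘ suc) x (nonzero ∘ suc))

module FullCover {n l} {G : Multigraph n l} (H : Cover G 3) (full : IsFull H) where

  source target : Fin l → Fin n
  source e = proj₁ (ends G e)
  target e = proj₂ (ends G e)

  row-≤1 : ∀ e a → length (filter (λ b → M H e a b 𝔹.≟ true) (allFin 3)) ≤ 1
  row-≤1 e a = filter-length-≤1 (λ b → M H e a b 𝔹.≟ true) (allFin⁺ 3) (match₁ H e a _ _)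

  -- Each matching has at most 3 edges, and fullness says the matchings
  -- between u and v have 3 · e_G(u,v) edges in total: so all are perfect.
  matchSize≡3 : ∀ e → matchSize H e ≡ 3
  matchSize≡3 e = sum-map-maximal (matchSize H) (EG G (source e) (target e))
    (λ e′ → sum-map-≤ _ (allFin 3) (row-≤1 e′))
    (full (source e) (target e) (loopless G e))
    (∈-filter⁺ (λ e′ → joins? G e′ (source e) (target e)) (∈-allFin e) (inj₁ refl))

  row-nonempty : ∀ e a → Σ 𝔽₃ λ b → M H e a b ≡ true
  row-nonempty e a = positive-filter⇒∃ (λ b → M H e a b 𝔹.≟ true) (allFin 3)
    (≤-reflexive (sym (sum-map-maximal _ (allFin 3) (row-≤1 e) (matchSize≡3 e) (∈-allFin a))))

  π : Fin l → 𝔽₃ → 𝔽₃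
  π e a = proj₁ (row-nonempty e a)

  π-matched : ∀ e a → M H e a (π e a) ≡ true
  π-matched e a = proj₂ (row-nonempty e a)

  π-injective : ∀ e {a a′} → π e a ≡ π e a′ → a ≡ a′
  π-injective e {a} {a′} π≡ =
    match₂ H e a a′ (π e a) (π-matched e a) (subst (λ b → M H e a′ b ≡ true) (sym π≡) (π-matched e a′))

  factor : Fin l → Fun n
  factor e x = lookup x (target e) -₃ π e (lookup x (source e))

  colouringPolynomial : Fun n
  colouringPolynomial = ∏ factor

  degreeBelow-colouringPolynomial : DegreeBelow n (suc l) colouringPolynomial
  degreeBelow-colouringPolynomial = degreeBelow-∏ factor raises
    where
    expand : ∀ v u α β p → (v -₃ (α +₃ u ·₃ β)) ·₃ p ≡ v ·₃ p +₃ -₃ α ·₃ p +₃ -₃ β ·₃ (u ·₃ p)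
    expand = toWitness {a? = all? λ v → all? λ u → all? λ α → all? λ β → all? λ p → _ ≟ _} tt
    raises : ∀ e {k} {g : Fun n} → DegreeBelow n k g → DegreeBelow n (suc k) (λ x → factor e x ·₃ g x)
    raises e {k} {g} deg = degreeBelow-cong
      (λ x → trans (sym (expand (lookup x (target e)) (lookup x (source e)) α β (g x)))
                   (cong (λ t → (lookup x (target e) -₃ t) ·₃ g x)
                         (sym (injective⇒affine (π e) (π-injective e) (lookup x (source e))))))
      (degreeBelow-+ (degreeBelow-+ (degreeBelow-var-· (target e) deg)
                                    (degreeBelow-mono (n≤1+n k) (degreeBelow-· (-₃ α) deg)))
                     (degreeBelow-· (-₃ β) (degreeBelow-var-· (source e) deg)))
      where
      α β : 𝔽₃
      α = π e 0F
      β = π e 1F -₃ π e 0F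

  nonzero⇒proper : ∀ x → colouringPolynomial x ≢ 0F → ProperChoice H (lookup x)
  nonzero⇒proper x nonzero e M≡true = nonzero (∏-zero factor x e (begin
    lookup x (target e) -₃ π e (lookup x (source e))   ≡⟨ cong (λ t → lookup x (target e) -₃ t) (sym π≡) ⟩
    lookup x (target e) -₃ lookup x (target e)         ≡⟨ -₃-inverseʳ (lookup x (target e)) ⟩
    0F                                                ∎))
    where
    open ≡-Reasoning
    π≡ : lookup x (target e) ≡ π e (lookup x (source e))
    π≡ = match₁ H e _ _ _ M≡true (π-matched e (lookup x (source e)))

  proper⇒nonzero : ∀ x → ProperChoice H (lookup x) → colouringPolynomial x ≢ 0F
  proper⇒nonzero x proper = ∏-nonzero factor x λ e factor≡0 →
    proper e (subst (λ b → M H e (lookup x (source e)) b ≡ true)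
                    (sym (-₃≡0⇒≡ _ _ factor≡0)) (π-matched e (lookup x (source e))))

2*n≡n+n : ∀ n → 2 * n ≡ n + n
2*n≡n+n n = cong (n +_) (+-identityʳ n)

theorem1p6 : (n l : ℕ) (G : Multigraph n l) → 1 ≤ n → χDP≤ G 3 → l ≤ 2 * n →
             (H : Cover G 3) → IsFull H →
             3 ^ (2 * n ∸ l) ≤ numColorings H * numColorings H
theorem1p6 n l G _ χDP≤3 _ H full = begin
  3 ^ (2 * n ∸ l)                    ≡⟨ cong (λ m → 3 ^ (m ∸ l)) (2*n≡n+n n) ⟩
  3 ^ (n + n ∸ l)                    ≤⟨ nonzerosBound n l P degreeBelow-colouringPolynomial P-positive ⟩
  nonzeros n P * nonzeros n P        ≤⟨ *-mono-≤ nonzeros≤colorings nonzeros≤colorings ⟩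
  numColorings H * numColorings H    ∎
  where
  open ≤-Reasoning
  open FullCover H full
  P : Fun n
  P = colouringPolynomial
  P-positive : 1 ≤ nonzeros n P
  P-positive with c , proper ← χDP≤⇒properChoice χDP≤3 H =
    nonzero-point⇒positive (tabulate c)
      (proper⇒nonzero (tabulate c) (properChoice-cong H (sym ∘ lookup∘tabulate c) proper))
  nonzeros≤colorings : nonzeros n P ≤ numColorings H
  nonzeros≤colorings = nonzeros≤count n P (isHColoring? H)
    (λ x → properChoice⇒coloring H x ∘ nonzero⇒proper x)
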